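{- Let $S$ be a string over an alphabet $\Sigma$, let $\$\notin\Sigma$, and let $ST_\$$ be the suffix tree of $S\$$. Let $s$ be the deepest $\$$-leaf of $ST_\$$. Then $\ell(s)=0$ and $d(s)=1$, and every other $\$$-leaf $y$ of $ST_\$$ satisfies $\ell(y)=1$ and $d(y)=0$ (all values computed in $ST_\$$).
   Context: The suffix tree of a string $T$ is the compacted trie of all suffixes of $T$; explicit nodes are the root, branching nodes and leaves, implicit nodes are positions inside edges; the label of a node is the string from the root to it and its length is the string depth. A $\$$-leaf of $ST_\$$ is a leaf whose incoming edge is labeled by the single letter $\$$; the deepest $\$$-leaf is the one of largest string depth. The tree is augmented with an auxiliary node $\perp$ which is the parent of the root; the edge $\perp\to\mathrm{root}$ is labeled by a wildcard symbol "?" matching every letter. $\sigma$ is the set of suffix links between internal explicit nodes (a node labeled $a_1\ldots a_m$ links to the node labeled $a_2\ldots a_m$), together with the link $\mathrm{root}\to\perp$. For an edge $e$, $\lambda(e)$ is its first letter. For a node $x$, $par(x)$ is its parent explicit node ($par(\mathrm{root})=\perp$). For an explicit node $x$, $\ell(x)$ is the number of leaves $y$ such that $par(y)\to par(x)$ is in $\sigma$ and $\lambda(par(y)\to y)=\lambda(par(x)\to x)$ (such $y$ are said to contribute to $\ell(x)$). $d(x)=|L_x|-\sum_{y\in V_x}\ell(y)$, where $L_x$ and $V_x$ are the sets of leaves and of explicit nodes of the subtree rooted at $x$. -}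

module Defs where

open import Data.List using (List; []; _∷_; _++_; [_]; length; map)
open import Data.Nat.ListAction using (sum)
open import Data.Maybe using (Maybe; just; nothing)
open import Data.Product using (Σ; ∃; ∃₂; _×_; _,_)
open import Data.Sum using (_⊎_)
open import Data.Nat using (ℕ; _≤_)
open import Data.Empty using (⊥)
open import Data.Unit using (⊤)
open import Data.Integer using (ℤ; +_; _-_)
open import Relation.Binary.PropositionalEquality using (_≡_; _≢_)
open import Relation.Nullary using (¬_)
open import Data.List.Membership.Propositional using (_∈_)
open import Data.List.Relation.Unary.Unique.Propositional using (Unique)
open import Data.List.Relation.Binary.Pointwise using (Pointwise)

-- Nodes of the augmented tree: the auxiliary node ⊥ₙ, or an explicit/implicit
-- node identified with its label (the string from the root to it).
data Node (C : Set) : Set where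
  ⊥ₙ  : Node C
  lab : List C → Node C

-- First letter of an edge: either the wildcard "?" (edge ⊥ → root) or a letter.
data EdgeLetter (C : Set) : Set where
  wild : EdgeLetter C
  ltr  : C → EdgeLetter C

Matches : {C : Set} → EdgeLetter C → EdgeLetter C → Set
Matches e e' = e ≡ wild ⊎ e' ≡ wild ⊎ e ≡ e'

Count : {C : Set} → (List C → Set) → ℕ → Set
Count {C} P k = Σ (List (List C)) λ ys →
  Unique ys × length ys ≡ k × (∀ y → (y ∈ ys → P y) × (P y → y ∈ ys))

Prefix : {C : Set} → List C → List C → Set
Prefix p w = ∃ λ v → p ++ v ≡ w

ProperPrefix : {C : Set} → List C → List C → Set
ProperPrefix p w = ∃ λ v → v ≢ [] × p ++ v ≡ w

-- Suffix tree of the text T (compacted trie of all suffixes of T),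
-- with nodes identified by their labels.
module SuffixTree {C : Set} (T : List C) where

  -- w is the label of a (possibly implicit) node: a substring of T
  Substr : List C → Set
  Substr w = ∃₂ λ u v → u ++ w ++ v ≡ T

  IsRoot : List C → Set
  IsRoot w = w ≡ []

  -- leaf: a suffix that is not a proper prefix of another suffix,
  -- i.e. a substring that cannot be extended to the right
  IsLeaf : List C → Set
  IsLeaf w = Substr w × (∀ c → ¬ Substr (w ++ [ c ]))

  IsBranching : List C → Set
  IsBranching w = Substr w × ∃₂ λ c c' → c ≢ c' × Substr (w ++ [ c ]) × Substr (w ++ [ c' ])

  IsExplicit : List C → Set
  IsExplicit w = IsRoot w ⊎ IsLeaf w ⊎ IsBranching w

  IsInternal : List C → Set
  IsInternal w = IsExplicit w × ¬ IsLeaf w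

  IsPar : Node C → Node C → Set
  IsPar ⊥ₙ      (lab x) = x ≡ []
  IsPar (lab p) (lab x) = IsExplicit p × ProperPrefix p x ×
                          (∀ q → IsExplicit q → ProperPrefix q x → Prefix q p)
  IsPar _       ⊥ₙ      = ⊥

  Link : Node C → Node C → Set
  Link (lab [])      ⊥ₙ       = ⊤
  Link (lab (a ∷ w)) (lab w') = w' ≡ w × IsInternal (a ∷ w) × IsInternal w
  Link _             _        = ⊥

  EdgeFirst : Node C → Node C → EdgeLetter C → Set
  EdgeFirst ⊥ₙ      (lab x) e = e ≡ wild
  EdgeFirst (lab p) (lab x) e = ∃₂ λ c v → p ++ c ∷ v ≡ x × e ≡ ltr c
  EdgeFirst _       ⊥ₙ      e = ⊥

  Contributes : List C → List C → Set
  Contributes x y = IsLeaf y × Σ (Node C) λ px → Σ (Node C) λ py →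
    Σ (EdgeLetter C) λ ex → Σ (EdgeLetter C) λ ey →
      IsPar px (lab x) × IsPar py (lab y) × Link py px ×
      EdgeFirst px (lab x) ex × EdgeFirst py (lab y) ey × Matches ey ex

  Ell : List C → ℕ → Set
  Ell x k = Count (Contributes x) k

  D : List C → ℤ → Set
  D x δ = Σ ℕ λ nL → Count (λ y → IsLeaf y × Prefix x y) nL ×
    Σ (List (List C)) λ Vx → Σ (List ℕ) λ ks →
      Unique Vx × (∀ y → (y ∈ Vx → IsExplicit y × Prefix x y) × (IsExplicit y × Prefix x y → y ∈ Vx)) ×
      Pointwise Ell Vx ks × δ ≡ (+ nL) - (+ sum ks)

  IsDollarLeaf : C → List C → Set
  IsDollarLeaf dollar y = IsLeaf y × ∃ λ p → IsPar (lab p) (lab y) × p ++ [ dollar ] ≡ y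

  IsDeepestDollarLeaf : C → List C → Set
  IsDeepestDollarLeaf dollar s =
    IsDollarLeaf dollar s × (∀ y → IsDollarLeaf dollar y → length y ≤ length s)

-- S$ over the alphabet Maybe A, where nothing plays the role of $ ∉ Σ = A
_$ : {A : Set} → List A → List (Maybe A)
S $ = map just S ++ [ nothing ]

-- Since $ occurs in S$ only as its last letter, the $-leaves are exactly the
-- strings w$ with w an explicit node that is a suffix of S, and a leaf
-- contributing to ℓ(p$) has the form bp$ with bp internal. For the deepest
-- $-leaf p₀$ such a bp$ would be a deeper $-leaf, so ℓ = 0. For any other
-- $-leaf p$, p is a proper suffix ap of p₀; as p₀ is branching (p₀$ extends it
-- and it is neither the root nor a leaf), so is ap, hence ap$ contributes, and
-- it is the only contributor because the letter preceding p in S is unique.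
-- Finally the subtree of a leaf y is {y}, so d(y) = 1 - ℓ(y).
module Submission where

open import Defs
open import Data.List using (List; []; _∷_; _++_; [_]; length; map; initLast; _∷ʳ′_)
open import Data.List.Properties
  using (++-assoc; ++-identityʳ; ++-identityʳ-unique; ++-cancelˡ; ++-cancelʳ; ++-conicalˡ;
         ++-conicalʳ; ∷-injective; ∷-injectiveˡ; ∷-injectiveʳ; ∷ʳ-injectiveʳ; length-++; length-++-≤ʳ)
open import Data.List.Membership.Propositional using (_∈_)
open import Data.List.Relation.Unary.Any using (here)
open import Data.List.Relation.Unary.All using ([])
open import Data.List.Relation.Unary.AllPairs using ([]; _∷_)
open import Data.List.Relation.Binary.Pointwise using ([]; _∷_)
open import Data.Maybe using (Maybe; just; nothing)
open import Data.Product using (_×_; _,_; proj₁; proj₂; ∃; ∃₂)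
open import Data.Sum using (inj₁; inj₂)
open import Data.Nat using (suc; _≤_; s≤s)
open import Data.Nat.Properties using (+-identityʳ; +-cancelʳ-≤; 1+n≰n; ≤-trans)
open import Data.Integer using (+_; _-_)
open import Data.Empty using (⊥-elim)
open import Relation.Nullary using (¬_)
open import Relation.Binary.PropositionalEquality
  using (_≡_; _≢_; refl; sym; trans; cong; cong₂; subst; subst₂)

Suffix : {C : Set} → List C → List C → Set
Suffix x w = ∃ λ u → u ++ x ≡ w

module _ {C : Set} where

  ++-∷-≢-[] : ∀ (p : List C) x r → p ++ x ∷ r ≢ []
  ++-∷-≢-[] []      _ _ ()
  ++-∷-≢-[] (_ ∷ _) _ _ ()

  prefix-antisym : ∀ {p q : List C} → Prefix p q → Prefix q p → p ≡ q
  prefix-antisym {p} (t , refl) (t′ , eq) = sym (trans (cong (p ++_) t≡[]) (++-identityʳ p))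
    where
    t≡[] : t ≡ []
    t≡[] = ++-conicalˡ t t′ (++-identityʳ-unique p (sym (trans (sym (++-assoc p t t′)) eq)))

  proper-prefix-of-snoc : ∀ (q w : List C) x → ProperPrefix q (w ++ [ x ]) → Prefix q w
  proper-prefix-of-snoc []      w       x _               = w , refl
  proper-prefix-of-snoc (a ∷ q) []      x (v , v≢[] , eq) = ⊥-elim (v≢[] (++-conicalʳ q v (∷-injectiveʳ eq)))
  proper-prefix-of-snoc (a ∷ q) (b ∷ w) x (v , v≢[] , eq)
    with t , qt≡w ← proper-prefix-of-snoc q w x (v , v≢[] , ∷-injectiveʳ eq)
    = t , cong₂ _∷_ (∷-injectiveˡ eq) qt≡w

  length-snoc-cancel-≤ : ∀ (xs ys : List C) {x y} →
    length (xs ++ [ x ]) ≤ length (ys ++ [ y ]) → length xs ≤ length ys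
  length-snoc-cancel-≤ xs ys le =
    +-cancelʳ-≤ 1 (length xs) (length ys) (subst₂ _≤_ (length-++ xs) (length-++ ys) le)

  suffix-of-shorter : ∀ (u a u′ b : List C) → u ++ a ≡ u′ ++ b → length b ≤ length a → Suffix b a
  suffix-of-shorter []      a u′       b eq le = u′ , sym eq
  suffix-of-shorter (x ∷ u) a []       b eq le = ⊥-elim (1+n≰n (≤-trans (s≤s (length-++-≤ʳ a {u})) len-ua≤a))
    where
    len-ua≤a : suc (length (u ++ a)) ≤ length a
    len-ua≤a = subst (_≤ length a) (cong length (sym eq)) le
  suffix-of-shorter (x ∷ u) a (y ∷ u′) b eq le = suffix-of-shorter u a u′ b (∷-injectiveʳ eq) le

  proper-suffix-split : ∀ {p p₀ : List C} → Suffix p p₀ → p ≢ p₀ → ∃₂ λ w a → w ++ a ∷ p ≡ p₀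
  proper-suffix-split {p} (u , eq) p≢p₀ with initLast u
  ... | []       = ⊥-elim (p≢p₀ eq)
  ... | w ∷ʳ′ a = w , a , trans (sym (++-assoc w [ a ] p)) eq

  preceding-letter-unique : ∀ (l l′ : List C) a b p → l ++ a ∷ p ≡ l′ ++ b ∷ p → a ≡ b
  preceding-letter-unique l l′ a b p eq = ∷ʳ-injectiveʳ l l′ (++-cancelʳ p (l ++ [ a ]) (l′ ++ [ b ])
    (trans (++-assoc l [ a ] p) (trans eq (sym (++-assoc l′ [ b ] p)))))

  count-none : ∀ {P : List C → Set} → (∀ y → ¬ P y) → Count P 0
  count-none none = [] , [] , refl , λ y → (λ ()) , λ Py → ⊥-elim (none y Py)

  ∈-singleton-iff : ∀ {P : List C → Set} {z} → P z → (∀ y → P y → y ≡ z) →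
    ∀ y → (y ∈ [ z ] → P y) × (P y → y ∈ [ z ])
  ∈-singleton-iff Pz only y = (λ { (here refl) → Pz }) , λ Py → here (only y Py)

  count-unique : ∀ {P : List C → Set} {z} → P z → (∀ y → P y → y ≡ z) → Count P 1
  count-unique {z = z} Pz only = [ z ] , [] ∷ [] , refl , ∈-singleton-iff Pz only

module _ {C : Set} (T : List C) where
  open SuffixTree T

  substr-suffix : ∀ w x → Substr (w ++ x) → Substr x
  substr-suffix w x (u , v , eq) =
    u ++ w , v , trans (trans (++-assoc u w (x ++ v)) (cong (u ++_) (sym (++-assoc w x v)))) eq

  substr-prefix : ∀ w x → Substr (w ++ x) → Substr w
  substr-prefix w x (u , v , eq) = u , x ++ v , trans (cong (u ++_) (sym (++-assoc w x v))) eq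

  explicit⇒substr : ∀ {x} → IsExplicit x → Substr x
  explicit⇒substr (inj₁ refl)        = [] , T , refl
  explicit⇒substr (inj₂ (inj₁ leaf)) = proj₁ leaf
  explicit⇒substr (inj₂ (inj₂ br))   = proj₁ br

  leaf-maximal : ∀ {y z} → IsLeaf y → Substr z → Prefix y z → z ≡ y
  leaf-maximal {y} leaf sub ([]    , eq) = trans (sym eq) (++-identityʳ y)
  leaf-maximal {y} leaf sub (c ∷ v , eq) = ⊥-elim (proj₂ leaf c (substr-prefix (y ++ [ c ]) v
    (subst Substr (trans (sym eq) (sym (++-assoc y [ c ] v))) sub)))

  explicit-extendable⇒internal : ∀ {x c} → IsExplicit x → Substr (x ++ [ c ]) → IsInternal x
  explicit-extendable⇒internal {c = c} ex sub = ex , λ leaf → proj₂ leaf c sub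

  explicit-extendable⇒branching : ∀ {x c} → IsExplicit x → x ≢ [] → Substr (x ++ [ c ]) → IsBranching x
  explicit-extendable⇒branching (inj₁ root)        x≢[] sub = ⊥-elim (x≢[] root)
  explicit-extendable⇒branching (inj₂ (inj₁ leaf)) x≢[] sub = ⊥-elim (proj₂ leaf _ sub)
  explicit-extendable⇒branching (inj₂ (inj₂ br))   x≢[] sub = br

  branching⇒internal : ∀ {x} → IsBranching x → IsInternal x
  branching⇒internal br@(_ , _ , _ , _ , sub , _) = explicit-extendable⇒internal (inj₂ (inj₂ br)) sub

  branching-suffix : ∀ w x → IsBranching (w ++ x) → IsBranching x
  branching-suffix w x (sub , c , c′ , c≢c′ , subc , subc′) =
    substr-suffix w x sub , c , c′ , c≢c′ , extend c subc , extend c′ subc′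
    where
    extend : ∀ d → Substr ((w ++ x) ++ [ d ]) → Substr (x ++ [ d ])
    extend d s = substr-suffix w (x ++ [ d ]) (subst Substr (++-assoc w x [ d ]) s)

  par-snoc : ∀ {p c} → IsExplicit p → IsPar (lab p) (lab (p ++ [ c ]))
  par-snoc {p} {c} ex = ex , ([ c ] , (λ ()) , refl) , λ q _ q<pc → proper-prefix-of-snoc q p c q<pc

  par-snoc-unique : ∀ {p c} q → IsExplicit p → IsPar q (lab (p ++ [ c ])) → q ≡ lab p
  par-snoc-unique {p} {c} ⊥ₙ      ex pc≡[]               = ⊥-elim (++-∷-≢-[] p c [] pc≡[])
  par-snoc-unique {p} {c} (lab q) ex (_ , q<pc , maximal) =
    cong lab (prefix-antisym (proper-prefix-of-snoc q p c q<pc) (maximal p ex ([ c ] , (λ ()) , refl)))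

  link-source : ∀ {py p} → Link py (lab p) → ∃ λ b → py ≡ lab (b ∷ p) × IsInternal (b ∷ p)
  link-source {lab (b ∷ _)} (refl , int , _) = b , refl , int

  edge-first-snoc : ∀ {p c e} → EdgeFirst (lab p) (lab (p ++ [ c ])) e → e ≡ ltr c
  edge-first-snoc {p} (c′ , v , eq , refl) = cong ltr (∷-injectiveˡ (++-cancelˡ p _ _ eq))

  matches-ltr : ∀ {a b : C} → Matches (ltr a) (ltr b) → a ≡ b
  matches-ltr (inj₁ ())
  matches-ltr (inj₂ (inj₁ ()))
  matches-ltr (inj₂ (inj₂ refl)) = refl

  contributor-shape : ∀ {p c z} → IsExplicit p → Contributes (p ++ [ c ]) z →
    ∃₂ λ b v → IsInternal (b ∷ p) × IsLeaf z × z ≡ (b ∷ p) ++ c ∷ v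
  contributor-shape ex (leaf , px , py , _ , _ , parX , _ , link , edgeX , edgeY , match)
    with refl ← par-snoc-unique px ex parX
    with b , refl , int ← link-source link
    with c′ , v , refl , refl ← edgeY
    with refl ← edge-first-snoc edgeX
    with refl ← matches-ltr match
    = b , v , int , leaf , refl

  contributes-snoc : ∀ {p b c} → IsLeaf ((b ∷ p) ++ [ c ]) → IsInternal (b ∷ p) → IsInternal p →
    Contributes (p ++ [ c ]) ((b ∷ p) ++ [ c ])
  contributes-snoc {p} {b} {c} leaf intBP intP =
    leaf , lab p , lab (b ∷ p) , ltr c , ltr c , par-snoc (proj₁ intP) , par-snoc (proj₁ intBP) ,
    (refl , intBP , intP) , (c , [] , refl , refl) , (c , [] , refl , refl) , inj₂ (inj₂ refl)

  d-leaf : ∀ {y k} → IsLeaf y → Ell y k → D y (+ 1 - + k)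
  d-leaf {y} {k} leaf ell =
    1 , count-unique (leaf , [] , ++-identityʳ y) (λ z (leafZ , y≤z) → leaf-maximal leaf (proj₁ leafZ) y≤z) ,
    [ y ] , [ k ] , [] ∷ [] ,
    ∈-singleton-iff (inj₂ (inj₁ leaf) , [] , ++-identityʳ y)
                    (λ z (exZ , y≤z) → leaf-maximal leaf (explicit⇒substr exZ) y≤z) ,
    ell ∷ [] , cong (λ m → + 1 - + m) (sym (+-identityʳ k))

$-last : ∀ {A : Set} (S : List A) l r → l ++ nothing ∷ r ≡ S $ → r ≡ [] × l ≡ map just S
$-last []      []      r eq = ∷-injectiveʳ eq , refl
$-last (x ∷ S) []      r ()
$-last []      (y ∷ l) r eq = ⊥-elim (++-∷-≢-[] l nothing r (∷-injectiveʳ eq))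
$-last (x ∷ S) (y ∷ l) r eq with y≡x , rest ← ∷-injective eq
  with r≡[] , l≡S ← $-last S l r rest
  = r≡[] , cong₂ _∷_ y≡x l≡S

module _ {A : Set} (S : List A) where
  open SuffixTree (S $)

  substr-$ : ∀ x r → Substr (x ++ nothing ∷ r) → r ≡ [] × Suffix x (map just S)
  substr-$ x r (u , v , eq)
    with r++v≡[] , ux≡S ← $-last S (u ++ x) (r ++ v)
           (trans (trans (++-assoc u x (nothing ∷ r ++ v)) (cong (u ++_) (sym (++-assoc x (nothing ∷ r) v)))) eq)
    = ++-conicalˡ r v r++v≡[] , u , ux≡S

  $-leaf : ∀ {w} → Suffix w (map just S) → IsLeaf (w ++ [ nothing ])
  $-leaf {w} (u , uw≡S) = (u , [] , in-S$) , unextendable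
    where
    in-S$ : u ++ (w ++ [ nothing ]) ++ [] ≡ S $
    in-S$ = trans (cong (u ++_) (++-identityʳ (w ++ [ nothing ])))
                  (trans (sym (++-assoc u w [ nothing ])) (cong (_++ [ nothing ]) uw≡S))
    unextendable : ∀ c → ¬ Substr ((w ++ [ nothing ]) ++ [ c ])
    unextendable c sub with () , _ ← substr-$ w [ c ] (subst Substr (++-assoc w [ nothing ] [ c ]) sub)

  $-contributor : ∀ {p z} → IsExplicit p → Contributes (p ++ [ nothing ]) z →
    ∃ λ b → IsInternal (b ∷ p) × z ≡ (b ∷ p) ++ [ nothing ] × Suffix (b ∷ p) (map just S)
  $-contributor {p} ex c
    with b , v , int , leaf , refl ← contributor-shape (S $) ex c
    with refl , suf ← substr-$ (b ∷ p) v (proj₁ leaf)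
    = b , int , refl , suf

  ell-deepest : ∀ {p₀} → IsExplicit p₀ →
    (∀ y → IsDollarLeaf nothing y → length y ≤ length (p₀ ++ [ nothing ])) → Ell (p₀ ++ [ nothing ]) 0
  ell-deepest {p₀} ex deepest = count-none λ z c →
    let b , int , _ , suf = $-contributor ex c
    in 1+n≰n (deepest ((b ∷ p₀) ++ [ nothing ]) ($-leaf suf , b ∷ p₀ , par-snoc (S $) (proj₁ int) , refl))

  ell-shallower : ∀ {p p₀} → IsExplicit p → Substr (p ++ [ nothing ]) →
    IsExplicit p₀ → Substr (p₀ ++ [ nothing ]) → length p ≤ length p₀ → p ≢ p₀ →
    Ell (p ++ [ nothing ]) 1
  ell-shallower {p} {p₀} exP subP exP₀ subP₀ shorter p≢p₀
    with _ , u , up≡S ← substr-$ p [] subP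
    with _ , u₀ , u₀p₀≡S ← substr-$ p₀ [] subP₀
    with w , a , wap≡p₀ ← proper-suffix-split (suffix-of-shorter u₀ p₀ u p (trans u₀p₀≡S (sym up≡S)) shorter) p≢p₀
    = count-unique (contributes-snoc (S $) ($-leaf ap-suffix) ap-internal p-internal) only
    where
    ap-suffix : Suffix (a ∷ p) (map just S)
    ap-suffix = u₀ ++ w , trans (++-assoc u₀ w (a ∷ p)) (trans (cong (u₀ ++_) wap≡p₀) u₀p₀≡S)
    p₀-branching : IsBranching p₀
    p₀-branching = explicit-extendable⇒branching (S $) exP₀ (λ p₀≡[] → ++-∷-≢-[] w a p (trans wap≡p₀ p₀≡[])) subP₀
    ap-internal : IsInternal (a ∷ p)
    ap-internal = branching⇒internal (S $) (branching-suffix (S $) w (a ∷ p) (subst IsBranching (sym wap≡p₀) p₀-branching))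
    p-internal : IsInternal p
    p-internal = explicit-extendable⇒internal (S $) exP subP
    only : ∀ z → Contributes (p ++ [ nothing ]) z → z ≡ (a ∷ p) ++ [ nothing ]
    only z c
      with b , _ , refl , u′ , u′bp≡S ← $-contributor exP c
      with refl ← preceding-letter-unique u′ (u₀ ++ w) b a p (trans u′bp≡S (sym (proj₂ ap-suffix)))
      = refl

lemma8 : {A : Set} (S : List A) (s : List (Maybe A)) →
    SuffixTree.IsDeepestDollarLeaf (S $) nothing s →
    (SuffixTree.Ell (S $) s 0 × SuffixTree.D (S $) s (+ 1)) ×
    (∀ y → SuffixTree.IsDollarLeaf (S $) nothing y → y ≢ s →
    SuffixTree.Ell (S $) y 1 × SuffixTree.D (S $) y (+ 0))
lemma8 S s ((leafS , p₀ , parS , refl) , deepest) = (ell₀ , d-leaf (S $) leafS ell₀) , others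
  where
  ell₀ : SuffixTree.Ell (S $) s 0
  ell₀ = ell-deepest S (proj₁ parS) deepest
  others : ∀ y → SuffixTree.IsDollarLeaf (S $) nothing y → y ≢ s →
    SuffixTree.Ell (S $) y 1 × SuffixTree.D (S $) y (+ 0)
  others y dollarY@(leafY , p , parY , refl) y≢s = ell₁ , d-leaf (S $) leafY ell₁
    where
    ell₁ : SuffixTree.Ell (S $) y 1
    ell₁ = ell-shallower S (proj₁ parY) (proj₁ leafY) (proj₁ parS) (proj₁ leafS)
             (length-snoc-cancel-≤ p p₀ (deepest y dollarY)) (λ { refl → y≢s refl })
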